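{- Let $k,n$ be positive integers with $n=qk+r$, $0<r<k$. For $s=0,1,\dots,q$, let $\overrightarrow{F_{n,k}^{s+1}}$ be the digraph whose vertex set is partitioned into $V_1,\dots,V_{q+1}$ with $|V_{s+1}|=r$ and $|V_i|=k$ for $i\neq s+1$, such that each $V_i$ induces a complete digraph, $V_i\mapsto V_j$ for all $1\le i<j\le q+1$, and there are no other arcs. Then $$LE(\overrightarrow{F_{n,k}^{1}})<LE(\overrightarrow{F_{n,k}^{2}})<\cdots<LE(\overrightarrow{F_{n,k}^{q}})<LE(\overrightarrow{F_{n,k}^{q+1}}).$$
   Context: For a digraph $G$ on vertices $v_1,\dots,v_n$, $A(G)$ is the adjacency matrix, $D^+(G)$ the diagonal outdegree matrix, $L(G)=D^+(G)-A(G)$, and the Laplacian energy is $LE(G)=\sum_{i=1}^n\lambda_i^2$ with $\lambda_i$ the eigenvalues of $L(G)$; equivalently $LE(G)=\sum_i(d_i^+)^2+c_2$, with $c_2$ the number of directed closed walks of length $2$. A complete digraph has both arcs between every pair of distinct vertices. For disjoint vertex sets, $V_i\mapsto V_j$ means every vertex of $V_i$ has an arc to every vertex of $V_j$ and there is no arc from $V_j$ to $V_i$. -}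

module Defs where

open import Data.Bool using (Bool; true; false; if_then_else_; _∧_; not)
open import Data.Nat as ℕ using (ℕ; zero; suc; _≡ᵇ_; _<ᵇ_; _≤ᵇ_; _∸_)
open import Data.Fin using (Fin; toℕ)
open import Data.List using (List; []; _∷_; map; upTo; allFin; sum)
open import Data.Integer as ℤ using (ℤ; +_)

Digraph : ℕ → Set
Digraph n = Fin n → Fin n → Bool


private
  bℤ : Bool → ℤ
  bℤ true  = + 1
  bℤ false = + 0

adj : ∀ {n} → Digraph n → Fin n → Fin n → ℤ
adj G i j = bℤ (G i j)

outdeg : ∀ {n} → Digraph n → Fin n → ℤ
outdeg {n} G i = ℤsum (map (adj G i) (allFin n))
  where
    ℤsum : List ℤ → ℤ
    ℤsum []       = + 0
    ℤsum (x ∷ xs) = x ℤ.+ ℤsum xs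

lap : ∀ {n} → Digraph n → Fin n → Fin n → ℤ
lap G i j = (if toℕ i ≡ᵇ toℕ j then outdeg G i else + 0) ℤ.- adj G i j

sumFin : (n : ℕ) → (Fin n → ℤ) → ℤ
sumFin zero    f = + 0
sumFin (suc n) f = f Fin.zero ℤ.+ sumFin n (λ i → f (Fin.suc i))
  where import Data.Fin as Fin

-- Laplacian energy LE(G) = Σ λᵢ² = tr(L(G)²) = Σᵢ Σⱼ Lᵢⱼ Lⱼᵢ
LE : ∀ {n} → Digraph n → ℤ
LE {n} G = sumFin n (λ i → sumFin n (λ j → lap G i j ℤ.* lap G j i))

-- Block sizes of F^{s+1}_{n,k} (blocks indexed 0..q, i.e. V_{i+1} has index i):
-- block s has size r, every other block has size k.
blockSizes : (q k r s : ℕ) → List ℕ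
blockSizes q k r s = map (λ i → if i ≡ᵇ s then r else k) (upTo (suc q))

blockOf : List ℕ → ℕ → ℕ
blockOf []         m = 0
blockOf (sz ∷ szs) m = if m <ᵇ sz then 0 else suc (blockOf szs (m ∸ sz))

-- The digraph F^{s+1}_{n,k} on vertices Fin n (n = qk + r):
-- arc u → v iff u ≠ v and block(u) ≤ block(v)
-- (complete digraph inside each block, V_i ↦ V_j for i < j, no other arcs).
F : (n q k r s : ℕ) → Digraph n
F n q k r s u v =
  not (toℕ u ≡ᵇ toℕ v) ∧ (blockOf (blockSizes q k r s) (toℕ u) ≤ᵇ blockOf (blockSizes q k r s) (toℕ v))

{-# OPTIONS --safe #-}
-- For a loopless digraph LE = Σ (d⁺)² + c₂. In F a vertex of the block Vⱼ has
-- outdegree Nⱼ - 1, where Nⱼ = |Vⱼ| + … + |V_{q+1}|, and lies on |Vⱼ| - 1 closed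
-- walks of length 2, so LE = Σⱼ |Vⱼ| ((Nⱼ - 1)² + |Vⱼ| - 1). Moving the small block
-- one place later swaps two adjacent blocks of sizes r and k; only their two terms
-- change, and the energy grows by r k (k - r) > 0.
module Submission where

open import Defs
open import Data.Nat using (ℕ; suc; _+_; _*_; _<_)
open import Data.Integer using () renaming (_<_ to _<ℤ_)
open import Relation.Binary.PropositionalEquality using (_≡_)

open import Algebra.Properties.CommutativeSemigroup using (interchange)
open import Data.Bool using (Bool; true; false; if_then_else_; _∧_; not)
open import Data.Fin using (Fin; zero; suc; toℕ)
open import Data.Fin.Properties using (toℕ<n)
open import Data.Integer.Base using (ℤ; +_; -_; 0ℤ; 1ℤ; +<+)
  renaming (_+_ to _+ℤ_; _*_ to _*ℤ_; _-_ to _-ℤ_)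
import Data.Integer.Properties as ℤ
open import Data.Integer.Tactic.RingSolver using (solve-∀)
open import Data.List using (List; []; _∷_; map; allFin; tabulate; applyUpTo)
open import Data.List.Properties using (map-tabulate; map-upTo)
open import Data.Nat using (zero; _≤_; _∸_; _≡ᵇ_; _<ᵇ_; _≤ᵇ_; s≤s)
open import Data.Nat.ListAction using (sum)
import Data.Nat.Properties as ℕ
open import Function using (id; _∘_)
open import Relation.Binary.PropositionalEquality using (refl; sym; trans; cong; cong₂; module ≡-Reasoning)
open import Relation.Nullary.Decidable using (yes; no; dec-true; dec-false)

[_] : Bool → ℤ
[ true ]  = 1ℤ
[ false ] = 0ℤ

-- Through sumFin, so that LE over a relation on toℕ unfolds into these sums.
∑ : ℕ → (ℕ → ℤ) → ℤ
∑ n f = sumFin n (λ i → f (toℕ i))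

syntax ∑ n (λ a → e) = ∑[ a < n ] e

sumFin-cong : ∀ n {f g : Fin n → ℤ} → (∀ i → f i ≡ g i) → sumFin n f ≡ sumFin n g
sumFin-cong zero    eq = refl
sumFin-cong (suc n) eq = cong₂ _+ℤ_ (eq zero) (sumFin-cong n (eq ∘ suc))

∑-cong : ∀ n {f g : ℕ → ℤ} → (∀ a → a < n → f a ≡ g a) → ∑ n f ≡ ∑ n g
∑-cong n eq = sumFin-cong n (λ i → eq (toℕ i) (toℕ<n i))

∑-+ : ∀ n (f g : ℕ → ℤ) → ∑[ a < n ] (f a +ℤ g a) ≡ ∑ n f +ℤ ∑ n g
∑-+ zero    f g = refl
∑-+ (suc n) f g = trans (cong (f 0 +ℤ g 0 +ℤ_) (∑-+ n (f ∘ suc) (g ∘ suc)))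
                        (interchange ℤ.+-commutativeSemigroup (f 0) (g 0) _ _)

∑-- : ∀ n (f g : ℕ → ℤ) → ∑[ a < n ] (f a -ℤ g a) ≡ ∑ n f -ℤ ∑ n g
∑-- zero    f g = refl
∑-- (suc n) f g = begin
  f 0 -ℤ g 0 +ℤ ∑[ a < n ] (f (suc a) -ℤ g (suc a))
    ≡⟨ cong (f 0 -ℤ g 0 +ℤ_) (∑-- n (f ∘ suc) (g ∘ suc)) ⟩
  f 0 -ℤ g 0 +ℤ (∑ n (f ∘ suc) -ℤ ∑ n (g ∘ suc))
    ≡⟨ interchange ℤ.+-commutativeSemigroup (f 0) (- g 0) _ _ ⟩
  f 0 +ℤ ∑ n (f ∘ suc) +ℤ (- g 0 +ℤ - ∑ n (g ∘ suc))
    ≡⟨ cong (f 0 +ℤ ∑ n (f ∘ suc) +ℤ_) (sym (ℤ.neg-distrib-+ (g 0) _)) ⟩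
  f 0 +ℤ ∑ n (f ∘ suc) -ℤ (g 0 +ℤ ∑ n (g ∘ suc))
    ∎
  where open ≡-Reasoning

∑-const : ∀ n (x : ℤ) → ∑[ a < n ] x ≡ + n *ℤ x
∑-const zero    x = sym (ℤ.*-zeroˡ x)
∑-const (suc n) x = trans (cong (x +ℤ_) (∑-const n x)) (sym (ℤ.suc-* (+ n) x))

∑-δ : ∀ {n a} (x : ℤ) → a < n → ∑[ b < n ] (if a ≡ᵇ b then x else 0ℤ) ≡ x
∑-δ {suc n} {zero}  x _         = trans (cong (x +ℤ_) (trans (∑-const n 0ℤ) (ℤ.*-zeroʳ (+ n)))) (ℤ.+-identityʳ x)
∑-δ {suc n} {suc a} x (s≤s a<n) = trans (ℤ.+-identityˡ _) (∑-δ x a<n)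

∑-split : ∀ m n (f : ℕ → ℤ) → ∑ (m + n) f ≡ ∑ m f +ℤ ∑[ c < n ] f (m + c)
∑-split zero    n f = sym (ℤ.+-identityˡ _)
∑-split (suc m) n f = trans (cong (f 0 +ℤ_) (∑-split m n (f ∘ suc))) (sym (ℤ.+-assoc (f 0) _ _))

≡ᵇ-refl : ∀ a → (a ≡ᵇ a) ≡ true
≡ᵇ-refl a = dec-true (a ℕ.≟ a) refl

≤ᵇ-refl : ∀ a → (a ≤ᵇ a) ≡ true
≤ᵇ-refl a = dec-true (a ℕ.≤? a) ℕ.≤-refl

<ᵇ-suc : ∀ a b → (a <ᵇ suc b) ≡ (a ≤ᵇ b)
<ᵇ-suc zero    b = refl
<ᵇ-suc (suc a) b = refl

≤ᵇ-antisym : ∀ a b → (a ≤ᵇ b) ∧ (b ≤ᵇ a) ≡ (a ≡ᵇ b)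
≤ᵇ-antisym zero    zero    = refl
≤ᵇ-antisym zero    (suc b) = refl
≤ᵇ-antisym (suc a) zero    = refl
≤ᵇ-antisym (suc a) (suc b) rewrite <ᵇ-suc a b | <ᵇ-suc b a = ≤ᵇ-antisym a b

[∧]≡-[]*-[] : ∀ x y → [ x ∧ y ] ≡ (0ℤ -ℤ [ x ]) *ℤ (0ℤ -ℤ [ y ])
[∧]≡-[]*-[] true  true  = refl
[∧]≡-[]*-[] true  false = refl
[∧]≡-[]*-[] false y     = refl

∑-remove : ∀ {n a} (p : ℕ → Bool) → a < n → p a ≡ true →
           ∑[ b < n ] [ not (a ≡ᵇ b) ∧ p b ] ≡ ∑[ b < n ] [ p b ] -ℤ 1ℤ
∑-remove {n} {a} p a<n pa = begin
  ∑[ b < n ] [ not (a ≡ᵇ b) ∧ p b ]        ≡⟨ ∑-cong n (λ b _ → split b) ⟩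
  ∑[ b < n ] ([ p b ] -ℤ δ b)              ≡⟨ ∑-- n (λ b → [ p b ]) δ ⟩
  ∑[ b < n ] [ p b ] -ℤ ∑[ b < n ] δ b    ≡⟨ cong (∑[ b < n ] [ p b ] -ℤ_) (∑-δ 1ℤ a<n) ⟩
  ∑[ b < n ] [ p b ] -ℤ 1ℤ                 ∎
  where
  open ≡-Reasoning
  δ : ℕ → ℤ
  δ b = if a ≡ᵇ b then 1ℤ else 0ℤ

  split : ∀ b → [ not (a ≡ᵇ b) ∧ p b ] ≡ [ p b ] -ℤ δ b
  split b with a ℕ.≟ b
  ... | yes refl rewrite ≡ᵇ-refl a | pa = refl
  ... | no a≢b   rewrite dec-false (a ℕ.≟ b) a≢b = sym (ℤ.+-identityʳ [ p b ])

module _ (n : ℕ) (R : ℕ → ℕ → Bool) where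

  outdegℕ : ℕ → ℤ
  outdegℕ a = ∑[ b < n ] [ R a b ]

  lapℕ : ℕ → ℕ → ℤ
  lapℕ a b = (if a ≡ᵇ b then outdegℕ a else 0ℤ) -ℤ [ R a b ]

  energyℕ : ℤ
  energyℕ = ∑[ a < n ] ∑[ b < n ] (lapℕ a b *ℤ lapℕ b a)

adj≡[] : ∀ {n} (G : Digraph n) i j → adj G i j ≡ [ G i j ]
adj≡[] G i j with G i j
... | true  = refl
... | false = refl

tabulate-sum-unique : (S : List ℤ → ℤ) → S [] ≡ 0ℤ → (∀ x xs → S (x ∷ xs) ≡ x +ℤ S xs) →
                      ∀ {n} (f : Fin n → ℤ) {xs} → xs ≡ tabulate f → S xs ≡ sumFin n f
tabulate-sum-unique S S[] S∷ {zero}  f refl = S[]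
tabulate-sum-unique S S[] S∷ {suc n} f refl =
  trans (S∷ _ _) (cong (f zero +ℤ_) (tabulate-sum-unique S S[] S∷ (f ∘ suc) refl))

-- outdeg sums with a function local to its where-block, which cannot be named: it is
-- captured as the metavariable S, solved only after with has abstracted the list.
outdeg≡sumFin : ∀ {n} (G : Digraph n) i → outdeg G i ≡ sumFin n (adj G i)
outdeg≡sumFin {n} G i
  with map (adj G i) (allFin n) | map-tabulate id (adj G i) | tabulate-sum-unique _ refl (λ _ _ → refl) (adj G i)
... | _ | xs≡ | unique = unique xs≡

LE≡energyℕ : ∀ n (R : ℕ → ℕ → Bool) → LE {n} (λ u v → R (toℕ u) (toℕ v)) ≡ energyℕ n R
LE≡energyℕ n R = sumFin-cong n (λ i → sumFin-cong n (λ j → cong₂ _*ℤ_ (lap≡ i j) (lap≡ j i)))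
  where
  G : Digraph n
  G u v = R (toℕ u) (toℕ v)

  outdeg≡ : ∀ i → outdeg G i ≡ outdegℕ n R (toℕ i)
  outdeg≡ i = trans (outdeg≡sumFin G i) (sumFin-cong n (adj≡[] G i))

  lap≡ : ∀ i j → lap G i j ≡ lapℕ n R (toℕ i) (toℕ j)
  lap≡ i j = cong₂ (λ d x → (if toℕ i ≡ᵇ toℕ j then d else 0ℤ) -ℤ x) (outdeg≡ i) (adj≡[] G i j)

energyℕ-loopless : ∀ n (R : ℕ → ℕ → Bool) → (∀ a → R a a ≡ false) →
  energyℕ n R ≡ ∑[ a < n ] (outdegℕ n R a *ℤ outdegℕ n R a +ℤ ∑[ b < n ] [ R a b ∧ R b a ])
energyℕ-loopless n R loopless = ∑-cong n row
  where
  open ≡-Reasoning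
  d : ℕ → ℤ
  d = outdegℕ n R

  entry : ∀ a b → lapℕ n R a b *ℤ lapℕ n R b a ≡ (if a ≡ᵇ b then d a *ℤ d a else 0ℤ) +ℤ [ R a b ∧ R b a ]
  entry a b with a ℕ.≟ b
  ... | yes refl rewrite ≡ᵇ-refl a | loopless a =
    trans (cong₂ _*ℤ_ (ℤ.+-identityʳ (d a)) (ℤ.+-identityʳ (d a))) (sym (ℤ.+-identityʳ _))
  ... | no a≢b rewrite dec-false (a ℕ.≟ b) a≢b | dec-false (b ℕ.≟ a) (a≢b ∘ sym) =
    trans (sym ([∧]≡-[]*-[] (R a b) (R b a))) (sym (ℤ.+-identityˡ _))

  row : ∀ a → a < n → ∑[ b < n ] (lapℕ n R a b *ℤ lapℕ n R b a) ≡ d a *ℤ d a +ℤ ∑[ b < n ] [ R a b ∧ R b a ]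
  row a a<n = begin
    ∑[ b < n ] (lapℕ n R a b *ℤ lapℕ n R b a)  ≡⟨ ∑-cong n (λ b _ → entry a b) ⟩
    ∑[ b < n ] (δ b +ℤ [ R a b ∧ R b a ])      ≡⟨ ∑-+ n δ (λ b → [ R a b ∧ R b a ]) ⟩
    ∑ n δ +ℤ ∑[ b < n ] [ R a b ∧ R b a ]      ≡⟨ cong (_+ℤ ∑[ b < n ] [ R a b ∧ R b a ]) (∑-δ _ a<n) ⟩
    d a *ℤ d a +ℤ ∑[ b < n ] [ R a b ∧ R b a ] ∎
    where
    δ : ℕ → ℤ
    δ b = if a ≡ᵇ b then d a *ℤ d a else 0ℤ

-- F n q k r s u v is definitionally layered (blockOf (blockSizes q k r s)) (toℕ u) (toℕ v).
layered : (ℕ → ℕ) → ℕ → ℕ → Bool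
layered ℓ a b = not (a ≡ᵇ b) ∧ (ℓ a ≤ᵇ ℓ b)

layered-irrefl : ∀ ℓ a → layered ℓ a a ≡ false
layered-irrefl ℓ a rewrite ≡ᵇ-refl a = refl

layered-∧-flip : ∀ ℓ a b → layered ℓ a b ∧ layered ℓ b a ≡ not (a ≡ᵇ b) ∧ (ℓ a ≡ᵇ ℓ b)
layered-∧-flip ℓ a b with a ℕ.≟ b
... | yes refl rewrite ≡ᵇ-refl a = refl
... | no a≢b rewrite dec-false (a ℕ.≟ b) a≢b | dec-false (b ℕ.≟ a) (a≢b ∘ sym) = ≤ᵇ-antisym (ℓ a) (ℓ b)

-- The contribution of a vertex with outdegree m - 1 lying on c - 1 closed walks of length 2.
vertexEnergy : ℤ → ℤ → ℤ
vertexEnergy m c = (m -ℤ 1ℤ) *ℤ (m -ℤ 1ℤ) +ℤ (c -ℤ 1ℤ)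

energyℕ-layered : ∀ n ℓ → energyℕ n (layered ℓ)
  ≡ ∑[ a < n ] vertexEnergy (∑[ b < n ] [ ℓ a ≤ᵇ ℓ b ]) (∑[ b < n ] [ ℓ a ≡ᵇ ℓ b ])
energyℕ-layered n ℓ = trans (energyℕ-loopless n (layered ℓ) (layered-irrefl ℓ)) (∑-cong n row)
  where
  row : ∀ a → a < n →
    outdegℕ n (layered ℓ) a *ℤ outdegℕ n (layered ℓ) a +ℤ ∑[ b < n ] [ layered ℓ a b ∧ layered ℓ b a ]
    ≡ vertexEnergy (∑[ b < n ] [ ℓ a ≤ᵇ ℓ b ]) (∑[ b < n ] [ ℓ a ≡ᵇ ℓ b ])
  row a a<n = cong₂ (λ d w → d *ℤ d +ℤ w)
    (∑-remove (λ b → ℓ a ≤ᵇ ℓ b) a<n (≤ᵇ-refl (ℓ a)))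
    (trans (∑-cong n (λ b _ → cong [_] (layered-∧-flip ℓ a b)))
           (∑-remove (λ b → ℓ a ≡ᵇ ℓ b) a<n (≡ᵇ-refl (ℓ a))))

weightedSum : List ℕ → (ℕ → ℤ) → ℤ
weightedSum []      f = 0ℤ
weightedSum (b ∷ L) f = + b *ℤ f 0 +ℤ weightedSum L (f ∘ suc)

weightedSum-cong : ∀ L {f g : ℕ → ℤ} → (∀ j → f j ≡ g j) → weightedSum L f ≡ weightedSum L g
weightedSum-cong []      eq = refl
weightedSum-cong (b ∷ L) eq = cong₂ (λ x y → + b *ℤ x +ℤ y) (eq 0) (weightedSum-cong L (eq ∘ suc))

weightedSum-const : ∀ L (x : ℤ) → weightedSum L (λ _ → x) ≡ + sum L *ℤ x
weightedSum-const []      x = sym (ℤ.*-zeroˡ x)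
weightedSum-const (b ∷ L) x = begin
  + b *ℤ x +ℤ weightedSum L (λ _ → x)  ≡⟨ cong (+ b *ℤ x +ℤ_) (weightedSum-const L x) ⟩
  + b *ℤ x +ℤ + sum L *ℤ x             ≡⟨ sym (ℤ.*-distribʳ-+ x (+ b) (+ sum L)) ⟩
  (+ b +ℤ + sum L) *ℤ x                ≡⟨ cong (_*ℤ x) (sym (ℤ.pos-+ b (sum L))) ⟩
  + (b + sum L) *ℤ x                   ∎
  where open ≡-Reasoning

weightedSum-∷-zero : ∀ b L (f : ℕ → ℤ) → f 0 ≡ 0ℤ → weightedSum (b ∷ L) f ≡ weightedSum L (f ∘ suc)
weightedSum-∷-zero b L f f0≡0 =
  trans (cong (_+ℤ weightedSum L _) (trans (cong (+ b *ℤ_) f0≡0) (ℤ.*-zeroʳ (+ b)))) (ℤ.+-identityˡ _)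

blockOf-< : ∀ {a b} L → a < b → blockOf (b ∷ L) a ≡ 0
blockOf-< {a} {b} L a<b rewrite dec-true (a ℕ.<? b) a<b = refl

blockOf-+ : ∀ b L c → blockOf (b ∷ L) (b + c) ≡ suc (blockOf L c)
blockOf-+ b L c rewrite dec-false (b + c ℕ.<? b) (ℕ.m+n≮m b c) | ℕ.m+n∸m≡n b c = refl

∑-blockOf : ∀ L (f : ℕ → ℤ) → ∑[ a < sum L ] f (blockOf L a) ≡ weightedSum L f
∑-blockOf []      f = refl
∑-blockOf (b ∷ L) f = begin
  ∑[ a < b + sum L ] f (blockOf (b ∷ L) a)
    ≡⟨ ∑-split b (sum L) (f ∘ blockOf (b ∷ L)) ⟩
  ∑[ a < b ] f (blockOf (b ∷ L) a) +ℤ ∑[ c < sum L ] f (blockOf (b ∷ L) (b + c))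
    ≡⟨ cong₂ _+ℤ_ (∑-cong b (λ a a<b → cong f (blockOf-< L a<b)))
                  (∑-cong (sum L) (λ c _ → cong f (blockOf-+ b L c))) ⟩
  ∑[ a < b ] f 0 +ℤ ∑[ c < sum L ] f (suc (blockOf L c))
    ≡⟨ cong₂ _+ℤ_ (∑-const b (f 0)) (∑-blockOf L (f ∘ suc)) ⟩
  + b *ℤ f 0 +ℤ weightedSum L (f ∘ suc)
    ∎
  where open ≡-Reasoning

-- Each of the b vertices of the first block has outdegree b + sum L - 1 and lies
-- on b - 1 closed walks of length 2.
blockEnergy : List ℕ → ℤ
blockEnergy []      = 0ℤ
blockEnergy (b ∷ L) = + b *ℤ vertexEnergy (+ b +ℤ + sum L) (+ b) +ℤ blockEnergy L

weightedSum-vertexEnergy : ∀ L →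
  weightedSum L (λ j → vertexEnergy (weightedSum L (λ i → [ j ≤ᵇ i ])) (weightedSum L (λ i → [ j ≡ᵇ i ])))
  ≡ blockEnergy L
weightedSum-vertexEnergy []      = refl
weightedSum-vertexEnergy (b ∷ L) =
  cong₂ _+ℤ_ (cong (+ b *ℤ_) (cong₂ vertexEnergy reach size))
             (trans (weightedSum-cong L (λ j → cong₂ vertexEnergy (reach-suc j) (size-suc j)))
                    (weightedSum-vertexEnergy L))
  where
  reach : weightedSum (b ∷ L) (λ i → [ 0 ≤ᵇ i ]) ≡ + b +ℤ + sum L
  reach = cong₂ _+ℤ_ (ℤ.*-identityʳ (+ b)) (trans (weightedSum-const L 1ℤ) (ℤ.*-identityʳ (+ sum L)))

  size : weightedSum (b ∷ L) (λ i → [ 0 ≡ᵇ i ]) ≡ + b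
  size = trans (cong₂ _+ℤ_ (ℤ.*-identityʳ (+ b)) (trans (weightedSum-const L 0ℤ) (ℤ.*-zeroʳ (+ sum L))))
               (ℤ.+-identityʳ (+ b))

  reach-suc : ∀ j → weightedSum (b ∷ L) (λ i → [ suc j ≤ᵇ i ]) ≡ weightedSum L (λ i → [ j ≤ᵇ i ])
  reach-suc j = trans (weightedSum-∷-zero b L (λ i → [ suc j ≤ᵇ i ]) refl)
                      (weightedSum-cong L (λ i → cong [_] (<ᵇ-suc j i)))

  size-suc : ∀ j → weightedSum (b ∷ L) (λ i → [ suc j ≡ᵇ i ]) ≡ weightedSum L (λ i → [ j ≡ᵇ i ])
  size-suc j = weightedSum-∷-zero b L (λ i → [ suc j ≡ᵇ i ]) refl

energyℕ-blockOf : ∀ L → energyℕ (sum L) (layered (blockOf L)) ≡ blockEnergy L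
energyℕ-blockOf L = begin
  energyℕ (sum L) (layered (blockOf L))
    ≡⟨ energyℕ-layered (sum L) (blockOf L) ⟩
  ∑[ a < sum L ] vertexEnergy (reach (blockOf L a)) (size (blockOf L a))
    ≡⟨ ∑-blockOf L (λ j → vertexEnergy (reach j) (size j)) ⟩
  weightedSum L (λ j → vertexEnergy (reach j) (size j))
    ≡⟨ weightedSum-cong L (λ j → cong₂ vertexEnergy (∑-blockOf L (λ i → [ j ≤ᵇ i ]))
                                                    (∑-blockOf L (λ i → [ j ≡ᵇ i ]))) ⟩
  weightedSum L (λ j → vertexEnergy (weightedSum L (λ i → [ j ≤ᵇ i ])) (weightedSum L (λ i → [ j ≡ᵇ i ])))
    ≡⟨ weightedSum-vertexEnergy L ⟩
  blockEnergy L
    ∎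
  where
  open ≡-Reasoning
  reach size : ℕ → ℤ
  reach j = ∑[ b < sum L ] [ j ≤ᵇ blockOf L b ]
  size  j = ∑[ b < sum L ] [ j ≡ᵇ blockOf L b ]

LE-blocks : ∀ L {n} → n ≡ sum L → LE {n} (λ u v → layered (blockOf L) (toℕ u) (toℕ v)) ≡ blockEnergy L
LE-blocks L refl = trans (LE≡energyℕ (sum L) (layered (blockOf L))) (energyℕ-blockOf L)

blockEnergy-swap : ∀ a b X → blockEnergy (b ∷ a ∷ X) ≡ blockEnergy (a ∷ b ∷ X) +ℤ + a *ℤ + b *ℤ (+ b -ℤ + a)
blockEnergy-swap a b X
  rewrite ℤ.pos-+ a (sum X) | ℤ.pos-+ b (sum X) = identity (+ a) (+ b) (+ sum X) (blockEnergy X)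
  where
  identity : ∀ A B T E →
    B *ℤ ((B +ℤ (A +ℤ T) -ℤ 1ℤ) *ℤ (B +ℤ (A +ℤ T) -ℤ 1ℤ) +ℤ (B -ℤ 1ℤ))
      +ℤ (A *ℤ ((A +ℤ T -ℤ 1ℤ) *ℤ (A +ℤ T -ℤ 1ℤ) +ℤ (A -ℤ 1ℤ)) +ℤ E)
    ≡ A *ℤ ((A +ℤ (B +ℤ T) -ℤ 1ℤ) *ℤ (A +ℤ (B +ℤ T) -ℤ 1ℤ) +ℤ (A -ℤ 1ℤ))
        +ℤ (B *ℤ ((B +ℤ T -ℤ 1ℤ) *ℤ (B +ℤ T -ℤ 1ℤ) +ℤ (B -ℤ 1ℤ)) +ℤ E)
      +ℤ A *ℤ B *ℤ (B -ℤ A)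
  identity = solve-∀

blockEnergy-swap-< : ∀ {a b} X → 0 < a → a < b → blockEnergy (a ∷ b ∷ X) <ℤ blockEnergy (b ∷ a ∷ X)
blockEnergy-swap-< {a} {b} X 0<a a<b = begin-strict
  blockEnergy (a ∷ b ∷ X)                                        ≡⟨ sym (ℤ.+-identityʳ _) ⟩
  blockEnergy (a ∷ b ∷ X) +ℤ 0ℤ                                  <⟨ ℤ.+-monoʳ-< (blockEnergy (a ∷ b ∷ X)) gain>0 ⟩
  blockEnergy (a ∷ b ∷ X) +ℤ + a *ℤ + b *ℤ (+ b -ℤ + a)         ≡⟨ sym (blockEnergy-swap a b X) ⟩
  blockEnergy (b ∷ a ∷ X)                                        ∎
  where
  open ℤ.≤-Reasoning
  gain≡ : + a *ℤ + b *ℤ (+ b -ℤ + a) ≡ + (a * b * (b ∸ a))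
  gain≡ = begin-equality
    + a *ℤ + b *ℤ (+ b -ℤ + a)   ≡⟨ cong (+ a *ℤ + b *ℤ_) (trans (ℤ.[+m]-[+n]≡m⊖n b a) (ℤ.⊖-≥ (ℕ.<⇒≤ a<b))) ⟩
    + a *ℤ + b *ℤ + (b ∸ a)      ≡⟨ cong (_*ℤ + (b ∸ a)) (sym (ℤ.pos-* a b)) ⟩
    + (a * b) *ℤ + (b ∸ a)       ≡⟨ sym (ℤ.pos-* (a * b) (b ∸ a)) ⟩
    + (a * b * (b ∸ a))          ∎
  gain>0 : 0ℤ <ℤ + a *ℤ + b *ℤ (+ b -ℤ + a)
  gain>0 rewrite gain≡ = +<+ (ℕ.*-mono-< (ℕ.*-mono-< 0<a (ℕ.<-trans 0<a a<b)) (ℕ.m<n⇒0<n∸m a<b))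

blockEnergy-∷-< : ∀ b {X Y} → sum X ≡ sum Y → blockEnergy X <ℤ blockEnergy Y →
                  blockEnergy (b ∷ X) <ℤ blockEnergy (b ∷ Y)
blockEnergy-∷-< b {Y = Y} ΣX≡ΣY X<Y rewrite ΣX≡ΣY = ℤ.+-monoʳ-< (+ b *ℤ vertexEnergy (+ b +ℤ + sum Y) (+ b)) X<Y

sum-applyUpTo-const : ∀ k m → sum (applyUpTo (λ _ → k) m) ≡ m * k
sum-applyUpTo-const k zero    = refl
sum-applyUpTo-const k (suc m) = cong (_+_ k) (sum-applyUpTo-const k m)

module _ (r k : ℕ) where

  smallBlockAt : ℕ → ℕ → List ℕ
  smallBlockAt m s = applyUpTo (λ i → if i ≡ᵇ s then r else k) m

  blockSizes≡smallBlockAt : ∀ q s → blockSizes q k r s ≡ smallBlockAt (suc q) s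
  blockSizes≡smallBlockAt q s = map-upTo (λ i → if i ≡ᵇ s then r else k) (suc q)

  sum-smallBlockAt : ∀ {q s} → s ≤ q → sum (smallBlockAt (suc q) s) ≡ q * k + r
  sum-smallBlockAt {q}     {zero}  _         =
    trans (cong (_+_ r) (sum-applyUpTo-const k q)) (ℕ.+-comm r (q * k))
  sum-smallBlockAt {suc q} {suc s} (s≤s s≤q) =
    trans (cong (_+_ k) (sum-smallBlockAt s≤q)) (sym (ℕ.+-assoc k (q * k) r))

  blockEnergy-smallBlockAt-< : 0 < r → r < k → ∀ {q s} → s < q →
    blockEnergy (smallBlockAt (suc q) s) <ℤ blockEnergy (smallBlockAt (suc q) (suc s))
  -- The two lists reduce to r ∷ k ∷ ks and k ∷ r ∷ ks.
  blockEnergy-smallBlockAt-< 0<r r<k {suc q} {zero}  _         = blockEnergy-swap-< (applyUpTo (λ _ → k) q) 0<r r<k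
  blockEnergy-smallBlockAt-< 0<r r<k {suc q} {suc s} (s≤s s<q) =
    blockEnergy-∷-< k {smallBlockAt (suc q) s} {smallBlockAt (suc q) (suc s)}
      (trans (sum-smallBlockAt (ℕ.<⇒≤ s<q)) (sym (sum-smallBlockAt s<q)))
      (blockEnergy-smallBlockAt-< 0<r r<k s<q)

lemma3p1 : (k n q r : ℕ) → 0 < r → r < k → n ≡ q * k + r →
    (s : ℕ) → s < q →
    LE (F n q k r s) <ℤ LE (F n q k r (suc s))
lemma3p1 k n q r 0<r r<k n≡qk+r s s<q = begin-strict
  LE (F n q k r s)                                ≡⟨ LE-F (ℕ.<⇒≤ s<q) ⟩
  blockEnergy (smallBlockAt r k (suc q) s)        <⟨ blockEnergy-smallBlockAt-< r k 0<r r<k s<q ⟩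
  blockEnergy (smallBlockAt r k (suc q) (suc s))  ≡⟨ sym (LE-F s<q) ⟩
  LE (F n q k r (suc s))                          ∎
  where
  open ℤ.≤-Reasoning
  LE-F : ∀ {t} → t ≤ q → LE (F n q k r t) ≡ blockEnergy (smallBlockAt r k (suc q) t)
  LE-F {t} t≤q = begin-equality
    LE (F n q k r t)                          ≡⟨ LE-blocks (blockSizes q k r t) n≡Σ ⟩
    blockEnergy (blockSizes q k r t)          ≡⟨ cong blockEnergy (blockSizes≡smallBlockAt r k q t) ⟩
    blockEnergy (smallBlockAt r k (suc q) t)  ∎
    where
    n≡Σ : n ≡ sum (blockSizes q k r t)
    n≡Σ = trans n≡qk+r (trans (sym (sum-smallBlockAt r k t≤q)) (cong sum (sym (blockSizes≡smallBlockAt r k q t))))
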